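{- Let $\mathcal G=(\mathcal N,\mathcal A,\mathcal R)$ be a first-order grammar, let $\mathbf V$ be a finite graph presentation (over $\mathcal N$) and let $\mathcal P$ be a partition of the set of nodes of $\mathbf V$. If two nodes $\nu_1,\nu_2$ of $\mathbf V$ lie in the same class of $\mathcal P$, then $\mathrm{EqL}(\mathrm{term}(\nu_1),\mathrm{term}(\nu_2))\ge\mathrm{LEqL}(\mathrm{dec}_{\mathcal P}(\mathbf V))$ in $\mathcal L^{\mathrm{act}}_{\mathcal G}$.
   Context: Terms: variables $\mathrm{Var}=\{x_1,x_2,\dots\}$, finite set $\mathcal N$ of nonterminals with arities; terms are rooted ordered (possibly infinite) trees labelled in $\mathcal N\cup\mathrm{Var}$ (variable-nodes are leaves, $A$-nodes have $\mathrm{arity}(A)$ ordered successors); $\mathcal T_{\mathcal N}$ is the set of regular terms. A finite graph presentation is a finite directed multigraph whose nodes are labelled in $\mathcal N\cup\mathrm{Var}$, a node labelled $x_i$ having no outgoing arcs and a node labelled $A$ having $\mathrm{arity}(A)$ ordered outgoing arcs; for a node $\nu$, $\mathrm{term}(\nu)$ is the (regular) term obtained by unfolding the graph from $\nu$. Quotient and decomposition: given a partition $\mathcal P$ of the nodes of $\mathbf V$, choose a representant node in each class; the quotient $\mathbf V/\mathcal P$ has as nodes the representants (with their labels), and each outgoing arc of a representant, leading in $\mathbf V$ to a node $\nu$, is redirected to the representant of the class of $\nu$. For a node $\nu$ of $\mathbf V$, $\mathrm{red}_{\mathcal P}(\nu)$ is the term of $\mathbf V/\mathcal P$ rooted at the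 representant of $\nu$'s class, and $\mathrm{red}^1_{\mathcal P}(\nu)$ is the term whose root carries the label of $\nu$ and whose $j$-th root-successor is $\mathrm{red}_{\mathcal P}(\nu_j)$, where $\nu_j$ is the target of the $j$-th outgoing arc of $\nu$ in $\mathbf V$ (if $\nu$ is labelled by a variable $x_i$, then $\mathrm{red}^1_{\mathcal P}(\nu)=x_i$). Put $\mathrm{dec}_{\mathcal P}(\mathbf V)=\{(\mathrm{red}^1_{\mathcal P}(\nu),\mathrm{red}_{\mathcal P}(\nu))\mid\nu$ a node of $\mathbf V\}$. First-order grammar $\mathcal G=(\mathcal N,\mathcal A,\mathcal R)$: finite action set, finite set of rules $A(x_1,\dots,x_m)\xrightarrow{a}E$, $m=\mathrm{arity}(A)$, $E$ finite with variables among $x_1,\dots,x_m$. LTS $\mathcal L^{\mathrm{act}}_{\mathcal G}$: states $\mathcal T_{\mathcal N}$, transitions $(A(x_1,\dots,x_m))\tau\xrightarrow{a}E\tau$ for every rule and substitution $\tau$. $\sim_0$ is total; $T\sim_{k+1}U$ iff each $T\xrightarrow{a}T'$ is matched by some $U\xrightarrow{a}U'$ with $T'\sim_kU'$ and vice versa, with the convention $x_i\not\sim_1H$ for every $H\neq x_i$. $\mathrm{EqL}(T,U)=\max\{k\in\mathbb N\cup\{\omega\}\mid T\sim_kU\}$ (with $\sim_\omega=\bigcap_k\sim_k$). For a set $\mathcal B$ of pairs of terms, $\mathrm{LEqL}(\mathcal B)=\min\{\mathrm{EqL}(E,F)\mid(E,F)\in\mathcal B\}$, with $\min\emptyset=\omega$.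 -}

module Defs where

open import Data.Nat using (ℕ; zero; suc)
open import Data.Fin using (Fin)
open import Data.List using (List)
open import Data.List.Membership.Propositional using (_∈_)
open import Data.Product using (Σ; _×_; _,_; proj₁; proj₂)
open import Data.Unit using (⊤)
open import Data.Sum using (_⊎_; inj₁; inj₂)
open import Relation.Binary.PropositionalEquality using (_≡_; sym; cong; subst)

record Ranked : Set where
  field
    nN    : ℕ
    arity : Fin nN → ℕ

open Ranked public

data ℕω : Set where
  fin : ℕ → ℕω
  ω   : ℕω

module _ (𝒩 : Ranked) where

  data Label : Set where
    nt  : Fin (nN 𝒩) → Label
    var : ℕ → Label

  arityL : Label → ℕ
  arityL (nt A)  = arity 𝒩 A
  arityL (var _) = 0

  -- A term is represented by a pointed labelled system (coalgebra) whose
  -- unfolding from the root is the tree; all notions below only observe a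
  -- term through  label  and  child, i.e. through its unfolding.
  record Term : Set₁ where
    field
      Node : Set
      lab₀ : Node → Label
      suc₀ : (v : Node) → Fin (arityL (lab₀ v)) → Node
      root : Node

  open Term public

  unfold : {N : Set} (lab : N → Label)
           (succ : (v : N) → Fin (arityL (lab v)) → N) → N → Term
  unfold {N} l s v = record { Node = N ; lab₀ = l ; suc₀ = s ; root = v }

  label : Term → Label
  label T = lab₀ T (root T)

  child : (T : Term) → Fin (arityL (label T)) → Term
  child T j = unfold (lab₀ T) (suc₀ T) (suc₀ T (root T) j)

  data FTerm (m : ℕ) : Set where
    fvar : Fin m → FTerm m
    fapp : (B : Fin (nN 𝒩)) → (Fin (arity 𝒩 B) → FTerm m) → FTerm m

  -- E τ : the system has the subterms of E and the nodes of all τ i;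
  -- a variable occurrence x_i of E behaves as the root of τ i.
  module _ {m : ℕ} (τ : Fin m → Term) where
    SNode : Set
    SNode = FTerm m ⊎ Σ (Fin m) (λ i → Node (τ i))

    slab : SNode → Label
    slab (inj₁ (fvar i))    = label (τ i)
    slab (inj₁ (fapp B es)) = nt B
    slab (inj₂ (i , v))     = lab₀ (τ i) v

    ssuc : (v : SNode) → Fin (arityL (slab v)) → SNode
    ssuc (inj₁ (fvar i))    j = inj₂ (i , suc₀ (τ i) (root (τ i)) j)
    ssuc (inj₁ (fapp B es)) j = inj₁ (es j)
    ssuc (inj₂ (i , v))     j = inj₂ (i , suc₀ (τ i) v j)

  applySubst : ∀ {m} → FTerm m → (Fin m → Term) → Term
  applySubst E τ = unfold (slab τ) (ssuc τ) (inj₁ E)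

  record GraphPres : Set where
    field
      size : ℕ
      lab  : Fin size → Label
      succ : (v : Fin size) → Fin (arityL (lab v)) → Fin size

  open GraphPres public

  term : (V : GraphPres) → Fin (size V) → Term
  term V = unfold (lab V) (succ V)

  -- A partition of the nodes together with a choice of representants,
  -- given by the representant map rep (idempotent); the classes are the
  -- fibres of rep, and rep ν is the chosen representant of ν's class.
  record Partition (V : GraphPres) : Set where
    field
      rep  : Fin (size V) → Fin (size V)
      idem : ∀ v → rep (rep v) ≡ rep v

  open Partition public

  module _ (V : GraphPres) (P : Partition V) where

    QNode : Set
    QNode = Σ (Fin (size V)) (λ v → rep P v ≡ v)

    qlab : QNode → Label
    qlab (v , _) = lab V v

    qsucc : (q : QNode) → Fin (arityL (qlab q)) → QNode
    qsucc (v , _) j = rep P (succ V v j) , idem P (succ V v j)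

    red : Fin (size V) → Term
    red ν = unfold qlab qsucc (rep P ν , idem P ν)

    -- red¹(ν): root labelled as ν, j-th root-successor red(ν_j).
    -- System: a fresh root node plus the quotient nodes.
    R1Node : Fin (size V) → Set
    R1Node ν = ⊤ ⊎ QNode

    r1lab : ∀ ν → R1Node ν → Label
    r1lab ν (inj₁ _) = lab V ν
    r1lab ν (inj₂ q) = qlab q

    r1suc : ∀ ν → (v : R1Node ν) → Fin (arityL (r1lab ν v)) → R1Node ν
    r1suc ν (inj₁ _) j = inj₂ (rep P (succ V ν j) , idem P (succ V ν j))
    r1suc ν (inj₂ q) j = inj₂ (qsucc q j)

    red¹ : Fin (size V) → Term
    red¹ ν = unfold (r1lab ν) (r1suc ν) (inj₁ _)

    -- dec_P(V), as a family of pairs indexed by the nodes of V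
    dec : Fin (size V) → Term × Term
    dec ν = red¹ ν , red ν

  record Rule (nA : ℕ) : Set where
    field
      lhs : Fin (nN 𝒩)
      act : Fin nA
      rhs : FTerm (arity 𝒩 lhs)

  open Rule public

  record Grammar : Set where
    field
      nA    : ℕ
      rules : List (Rule nA)

  open Grammar public

  module _ (G : Grammar) where

    record Trans (T : Term) (a : Fin (nA G)) : Set where
      field
        rule   : Rule (nA G)
        isRule : rule ∈ rules G
        lhsEq  : label T ≡ nt (lhs rule)
        actEq  : act rule ≡ a

    open Trans public

    target : ∀ {T a} → Trans T a → Term
    target {T} t =
      applySubst (rhs (rule t))
        (λ i → child T (subst Fin (sym (cong arityL (lhsEq t))) i))

    VarCond : Term → Term → Set
    VarCond T U = ∀ i → (label T ≡ var i → label U ≡ var i)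
                      × (label U ≡ var i → label T ≡ var i)

    Sim : ℕ → Term → Term → Set
    Sim zero    T U = ⊤
    Sim (suc k) T U =
      VarCond T U
      × (∀ a (t : Trans T a) → Σ (Trans U a) λ u → Sim k (target t) (target u))
      × (∀ a (u : Trans U a) → Σ (Trans T a) λ t → Sim k (target t) (target u))

    -- "EqL(T,U) ≥ n"  (i.e. T ~_n U, with ~_ω = ⋂_k ~_k)
    EqL≥ : Term → Term → ℕω → Set
    EqL≥ T U (fin k) = Sim k T U
    EqL≥ T U ω       = ∀ k → Sim k T U

    -- "LEqL(ℬ) ≥ n" for a set ℬ of pairs given as an indexed family
    LEqL≥ : {I : Set} → (I → Term × Term) → ℕω → Set
    LEqL≥ ℬ n = ∀ i → EqL≥ (proj₁ (ℬ i)) (proj₂ (ℬ i)) n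

module Submission where

-- Fix k.  Assume red¹(ν) ∼_k red(ν) for every node ν (the
-- hypothesis LEqL(dec_P(V)) ≥ k).  By induction on k we show
-- term(ν) ∼_k red(ν) for every ν: the roots of term(ν) and red¹(ν) carry
-- the same label, their j-th children are term(ν_j) and (a copy of)
-- red(ν_j), which are ∼_{k-1}-equivalent by induction; hence
-- term(ν) ∼_k red¹(ν) ∼_k red(ν).  If ν₁, ν₂ lie in the same class then
-- red(ν₁) and red(ν₂) are the very same term of V/P, so by transitivity
-- term(ν₁) ∼_k term(ν₂).  The case n = ω follows by applying this for all k.

open import Defs
open import Data.Nat using (ℕ; zero; suc)
open import Data.Fin using (Fin)
open import Data.Unit using (tt)
open import Data.Product using (_,_; proj₁; proj₂)
open import Data.Sum using (inj₁; inj₂)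
open import Data.Nat.Properties using (≡-irrelevant)
open import Relation.Binary.PropositionalEquality
  using (_≡_; refl; sym; trans; cong; subst)

-- Transports between the finite index sets Fin n.  Since equality on ℕ is
-- proof-irrelevant, composing casts only depends on the endpoints.
cast-coherent : ∀ {l m n} (p : l ≡ m) (q : m ≡ n) (r : l ≡ n) (i : Fin l) →
                subst Fin q (subst Fin p i) ≡ subst Fin r i
cast-coherent refl refl r i rewrite ≡-irrelevant r refl = refl

module _ (𝒩 : Ranked) (G : Grammar 𝒩) where

  infix 4 _∼[_]_
  _∼[_]_ : Term 𝒩 → ℕ → Term 𝒩 → Set
  T ∼[ k ] U = Sim 𝒩 G k T U

  castL : {L L′ : Label 𝒩} → L ≡ L′ → Fin (arityL 𝒩 L) → Fin (arityL 𝒩 L′)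
  castL e = subst Fin (cong (arityL 𝒩) e)

  ∼-sym : ∀ k {T U} → T ∼[ k ] U → U ∼[ k ] T
  ∼-sym zero _ = tt
  ∼-sym (suc k) (vc , fwd , bwd) =
    (λ i → proj₂ (vc i) , proj₁ (vc i)) ,
    (λ a u → let (t , s) = bwd a u in t , ∼-sym k s) ,
    (λ a t → let (u , s) = fwd a t in u , ∼-sym k s)

  ∼-trans : ∀ k {T U W} → T ∼[ k ] U → U ∼[ k ] W → T ∼[ k ] W
  ∼-trans zero _ _ = tt
  ∼-trans (suc k) (vc , fwd , bwd) (vc′ , fwd′ , bwd′) =
    (λ i → (λ e → proj₁ (vc′ i) (proj₁ (vc i) e)) ,
           (λ e → proj₂ (vc i) (proj₂ (vc′ i) e))) ,
    (λ a t → let (u , s) = fwd a t ; (w , s′) = fwd′ a u in w , ∼-trans k s s′) ,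
    (λ a w → let (u , s′) = bwd′ a w ; (t , s) = bwd a u in t , ∼-trans k s s′)

  ∼-down : ∀ k {T U} → T ∼[ suc k ] U → T ∼[ k ] U
  ∼-down zero _ = tt
  ∼-down (suc k) (vc , fwd , bwd) =
    vc ,
    (λ a t → let (u , s) = fwd a t in u , ∼-down k s) ,
    (λ a u → let (t , s) = bwd a u in t , ∼-down k s)

  -- Two labelled systems whose unfoldings from the roots coincide: a
  -- relation between nodes containing the roots, preserving labels and
  -- closed under taking corresponding successors.
  record Bisim (T U : Term 𝒩) : Set₁ where
    field
      R     : Node T → Node U → Set
      root∈ : R (root T) (root U)
      labEq : ∀ {v w} → R v w → lab₀ T v ≡ lab₀ U w
      succ∈ : ∀ {v w} (r : R v w) (j : Fin (arityL 𝒩 (lab₀ T v))) →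
              R (suc₀ T v j) (suc₀ U w (castL (labEq r) j))

  open Bisim

  child-bisim : ∀ {T U} (B : Bisim T U) (j : Fin (arityL 𝒩 (label 𝒩 T))) →
                Bisim (child 𝒩 T j) (child 𝒩 U (castL (labEq B (root∈ B)) j))
  child-bisim B j = record
    { R = R B ; root∈ = succ∈ B (root∈ B) j ; labEq = labEq B ; succ∈ = succ∈ B }

  -- The transitions of a term are determined by its root label; a rule
  -- usable at T is usable at any U with the same root label.
  transfer : ∀ {T U a} → label 𝒩 T ≡ label 𝒩 U → Trans 𝒩 G T a → Trans 𝒩 G U a
  transfer e t = record
    { rule = rule t ; isRule = isRule t
    ; lhsEq = trans (sym e) (lhsEq t) ; actEq = actEq t }

  ruleArgs : ∀ {T a} (t : Trans 𝒩 G T a) → Fin (arity 𝒩 (lhs (rule t))) → Term 𝒩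
  ruleArgs {T} t i = child 𝒩 T (subst Fin (sym (cong (arityL 𝒩) (lhsEq t))) i)

  ruleArgs-transfer : ∀ {T U a} (e : label 𝒩 T ≡ label 𝒩 U) (t : Trans 𝒩 G T a) i →
    child 𝒩 U (castL e (subst Fin (sym (cong (arityL 𝒩) (lhsEq t))) i))
      ≡ ruleArgs (transfer {U = U} e t) i
  ruleArgs-transfer {U = U} e t i =
    cong (child 𝒩 U)
      (cast-coherent (sym (cong (arityL 𝒩) (lhsEq t))) (cong (arityL 𝒩) e) _ i)

  var-bisim : ∀ {m} (τ : Fin m → Term 𝒩) (i : Fin m) →
              Bisim (applySubst 𝒩 (fvar i) τ) (τ i)
  var-bisim τ i = record
    { R = VarRel ; root∈ = at-root ; labEq = lab-eq ; succ∈ = succ-rel }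
    where
    data VarRel : SNode 𝒩 τ → Node (τ i) → Set where
      at-root : VarRel (inj₁ (fvar i)) (root (τ i))
      inside  : ∀ w → VarRel (inj₂ (i , w)) w

    lab-eq : ∀ {v w} → VarRel v w → slab 𝒩 τ v ≡ lab₀ (τ i) w
    lab-eq at-root    = refl
    lab-eq (inside w) = refl

    succ-rel : ∀ {v w} (r : VarRel v w) j →
               VarRel (ssuc 𝒩 τ v j) (suc₀ (τ i) w (castL (lab-eq r) j))
    succ-rel at-root    j = inside _
    succ-rel (inside w) j = inside _

  mutual
    ∼-byRoot : ∀ k {T U} (e : label 𝒩 T ≡ label 𝒩 U) →
               (∀ j → child 𝒩 T j ∼[ k ] child 𝒩 U (castL e j)) →
               T ∼[ suc k ] U
    ∼-byRoot k {T} {U} e children =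
      (λ i → (λ eT → trans (sym e) eT) , (λ eU → trans e eU)) ,
      (λ a t → transfer e t , matched e children t) ,
      (λ a u → transfer (sym e) u ,
               ∼-sym k (matched (sym e) (λ j → ∼-sym k (children′ j)) u))
      where
      children′ : ∀ j → child 𝒩 T (castL (sym e) j) ∼[ k ] child 𝒩 U j
      children′ j = subst (λ c → child 𝒩 T (castL (sym e) j) ∼[ k ] c)
        (cong (child 𝒩 U)
          (cast-coherent (cong (arityL 𝒩) (sym e)) (cong (arityL 𝒩) e) refl j))
        (children (castL (sym e) j))

      matched : ∀ {T′ U′ a} (e′ : label 𝒩 T′ ≡ label 𝒩 U′) →
                (∀ j → child 𝒩 T′ j ∼[ k ] child 𝒩 U′ (castL e′ j)) →
                (t : Trans 𝒩 G T′ a) →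
                target 𝒩 G t ∼[ k ] target 𝒩 G (transfer {U = U′} e′ t)
      matched e′ ch t = ∼-subst k (rhs (rule t)) _ _ λ i →
        subst (λ c → ruleArgs t i ∼[ k ] c) (ruleArgs-transfer e′ t i) (ch _)

    ∼-subst : ∀ k {m} (E : FTerm 𝒩 m) (τ τ′ : Fin m → Term 𝒩) →
              (∀ i → τ i ∼[ k ] τ′ i) →
              applySubst 𝒩 E τ ∼[ k ] applySubst 𝒩 E τ′
    ∼-subst zero E τ τ′ _ = tt
    ∼-subst (suc k) (fvar i) τ τ′ τ∼τ′ =
      ∼-trans (suc k) (bisim⇒∼ (suc k) (var-bisim τ i))
        (∼-trans (suc k) (τ∼τ′ i) (∼-sym (suc k) (bisim⇒∼ (suc k) (var-bisim τ′ i))))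
    ∼-subst (suc k) (fapp B es) τ τ′ τ∼τ′ =
      ∼-byRoot k refl λ j → ∼-subst k (es j) τ τ′ (λ i → ∼-down k (τ∼τ′ i))

    bisim⇒∼ : ∀ k {T U} → Bisim T U → T ∼[ k ] U
    bisim⇒∼ zero _ = tt
    bisim⇒∼ (suc k) B =
      ∼-byRoot k (labEq B (root∈ B)) λ j → bisim⇒∼ k (child-bisim B j)

  module _ (V : GraphPres 𝒩) (P : Partition 𝒩 V) where

    red-class : ∀ ν₁ ν₂ → rep P ν₁ ≡ rep P ν₂ → Bisim (red 𝒩 V P ν₁) (red 𝒩 V P ν₂)
    red-class ν₁ ν₂ same = record
      { R = SameNode ; root∈ = same ; labEq = λ {q} {q′} → lab-eq {q} {q′}
      ; succ∈ = λ {q} {q′} → succ-rel {q} {q′} }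
      where
      SameNode : QNode 𝒩 V P → QNode 𝒩 V P → Set
      SameNode q q′ = proj₁ q ≡ proj₁ q′

      lab-eq : ∀ {q q′} → SameNode q q′ → qlab 𝒩 V P q ≡ qlab 𝒩 V P q′
      lab-eq {v , _} {.v , _} refl = refl

      succ-rel : ∀ {q q′} (r : SameNode q q′) j →
        SameNode (qsucc 𝒩 V P q j) (qsucc 𝒩 V P q′ (castL (lab-eq {q} {q′} r) j))
      succ-rel {v , _} {.v , _} refl j = refl

    red¹-child : ∀ ν j → Bisim (red 𝒩 V P (succ V ν j)) (child 𝒩 (red¹ 𝒩 V P ν) j)
    red¹-child ν j = record
      { R = Copy ; root∈ = copy _ ; labEq = lab-eq ; succ∈ = succ-rel }
      where
      data Copy : QNode 𝒩 V P → R1Node 𝒩 V P ν → Set where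
        copy : ∀ q → Copy q (inj₂ q)

      lab-eq : ∀ {q w} → Copy q w → qlab 𝒩 V P q ≡ r1lab 𝒩 V P ν w
      lab-eq (copy q) = refl

      succ-rel : ∀ {q w} (r : Copy q w) j′ →
        Copy (qsucc 𝒩 V P q j′) (r1suc 𝒩 V P ν w (castL (lab-eq r) j′))
      succ-rel (copy q) j′ = copy _

    term∼red : ∀ k → (∀ ν → red¹ 𝒩 V P ν ∼[ k ] red 𝒩 V P ν) →
               ∀ ν → term 𝒩 V ν ∼[ k ] red 𝒩 V P ν
    term∼red zero _ _ = tt
    term∼red (suc k) dec∼ ν = ∼-trans (suc k) term∼red¹ (dec∼ ν)
      where
      term∼red¹ : term 𝒩 V ν ∼[ suc k ] red¹ 𝒩 V P ν
      term∼red¹ = ∼-byRoot k refl λ j →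
        ∼-trans k (term∼red k (λ ν′ → ∼-down k (dec∼ ν′)) (succ V ν j))
                  (bisim⇒∼ k (red¹-child ν j))

    same-class∼ : ∀ k → (∀ ν → red¹ 𝒩 V P ν ∼[ k ] red 𝒩 V P ν) →
                  ∀ ν₁ ν₂ → rep P ν₁ ≡ rep P ν₂ → term 𝒩 V ν₁ ∼[ k ] term 𝒩 V ν₂
    same-class∼ k dec∼ ν₁ ν₂ same =
      ∼-trans k (term∼red k dec∼ ν₁)
        (∼-trans k (bisim⇒∼ k (red-class ν₁ ν₂ same))
                   (∼-sym k (term∼red k dec∼ ν₂)))

proposition8 : (𝒩 : Ranked) (G : Grammar 𝒩) (V : GraphPres 𝒩) (P : Partition 𝒩 V)
    (ν₁ ν₂ : Fin (size V)) → rep P ν₁ ≡ rep P ν₂ →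
    ∀ (n : ℕω) → LEqL≥ 𝒩 G (dec 𝒩 V P) n →
    EqL≥ 𝒩 G (term 𝒩 V ν₁) (term 𝒩 V ν₂) n
proposition8 𝒩 G V P ν₁ ν₂ same (fin k) dec≥k =
  same-class∼ 𝒩 G V P k dec≥k ν₁ ν₂ same
proposition8 𝒩 G V P ν₁ ν₂ same ω dec≥ω k =
  same-class∼ 𝒩 G V P k (λ ν → dec≥ω ν k) ν₁ ν₂ same
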